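{- Let $w$ be a p-string with $\Pi_w\neq\emptyset$ having a period $q$. If $q\le \frac{|w|}{|\Pi_w|+1}$, then $\mathrm{period}(w)$ divides $q$.
   Context: Let $\Sigma$ and $\Pi$ be disjoint alphabets; a p-string is a string over $\Sigma\cup\Pi$, indexed from 0, with $w[i:j]=w[i]\cdots w[j-1]$. A permutation $f$ of $\Pi$ acts on p-strings letterwise, fixing letters of $\Sigma$; $x\equiv y$ iff $f(x)=y$ for some permutation $f$ of $\Pi$. For $p\in\mathbb{N}^+$, $p\le|w|$, $p$ is a period of $w$ iff $w[0:|w|-p]\equiv w[p:|w|]$; $\mathrm{period}(w)$ is the smallest period of a nonempty $w$. $\Pi_w$ is the set of parameter characters occurring in $w$. -}

module Defs where

open import Data.Nat using (ℕ; _≤_; _∸_)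
open import Data.List using (List; length; take; drop; map; mapMaybe; deduplicate)
open import Data.Sum using (_⊎_; inj₁; inj₂)
open import Data.Maybe using (Maybe; just; nothing)
open import Data.Product using (_×_; Σ)
open import Function.Bundles using (_↔_; Inverse)
open import Relation.Binary.PropositionalEquality using (_≡_)
open import Relation.Binary.Definitions using (DecidableEquality)

-- Letters of a p-string: static symbols from Σ (inj₁) or parameter symbols from Π (inj₂).
PString : Set → Set → Set
PString S P = List (S ⊎ P)

actLetter : {S P : Set} → (P → P) → S ⊎ P → S ⊎ P
actLetter f (inj₁ s) = inj₁ s
actLetter f (inj₂ a) = inj₂ (f a)

act : {S P : Set} → (P → P) → PString S P → PString S P
act f = map (actLetter f)

_≡ₚ_ : {S P : Set} → PString S P → PString S P → Set
_≡ₚ_ {S} {P} x y = Σ (P ↔ P) λ f → act (Inverse.to f) x ≡ y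

IsPeriod : {S P : Set} → PString S P → ℕ → Set
IsPeriod w p = (1 ≤ p) × (p ≤ length w) × (take (length w ∸ p) w ≡ₚ drop p w)

IsSmallestPeriod : {S P : Set} → PString S P → ℕ → Set
IsSmallestPeriod w p = IsPeriod w p × (∀ p′ → IsPeriod w p′ → p ≤ p′)

paramOf : {S P : Set} → S ⊎ P → Maybe P
paramOf (inj₁ _) = nothing
paramOf (inj₂ a) = just a

-- Π_w as a duplicate-free list of the parameter characters occurring in w.
paramChars : {S P : Set} → DecidableEquality P → PString S P → List P
paramChars _≟_ w = deduplicate _≟_ (mapMaybe paramOf w)

{-# OPTIONS --safe #-}
-- Let p = period(w) and q = p + r be periods of w, realised by permutations f and g of Π. If
-- |w| ≥ p + q and fg a = gf a for every parameter letter a occurring before position |w| − q,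
-- then f⁻¹g realises r as a period; so p ∣ r by induction on q, whence p ∣ q (Euclid).
-- The commutation fg a = gf a can be read off at any occurrence z of a with z + q + p < |w|, and
-- the bound q(|Π_w| + 1) ≤ |w| provides one: for a late occurrence y of a, the positions
-- y, y − q, …, y − kq (with |Π_w| = k + 1) and a parameter position below r (reached from y by
-- stepping down by r, which both periods allow) carry k + 2 parameters, so two carry the same
-- letter, and shifting this pair forward by a multiple of q moves one of them onto y and the other
-- early enough.
module Submission where

open import Data.Empty using (⊥-elim)
open import Data.Fin using (Fin; toℕ) renaming (zero to fzero; suc to fsuc)
import Data.Fin as Fin
open import Data.Fin.Properties using (pigeonhole; toℕ<n)
open import Data.List using (List; []; _∷_; length; take; drop; map; mapMaybe; lookup)
open import Data.List.Membership.Propositional using (_∈_)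
open import Data.List.Membership.Propositional.Properties using (∈-deduplicate⁺)
open import Data.List.Relation.Unary.Any using (here; there; index)
open import Data.List.Relation.Unary.Any.Properties using (lookup-index)
open import Data.Maybe using (Maybe; just; nothing)
import Data.Maybe as Maybe
open import Data.Nat
open import Data.Nat.Divisibility using (_∣_; _∣0; ∣-refl; ∣m∣n⇒∣m+n)
open import Data.Nat.Induction using (<-rec)
open import Data.Nat.Properties
open import Data.Nat.Tactic.RingSolver using (solve-∀)
open import Algebra.Properties.CommutativeSemigroup +-commutativeSemigroup using (xy∙z≈xz∙y)
open import Data.Product using (∃; ∃₂; _×_; _,_; proj₁; proj₂)
open import Data.Sum using (_⊎_; inj₁; inj₂)
open import Function using (_∘_)
open import Function.Bundles using (_↔_; Inverse)
open import Function.Construct.Composition using (_↔-∘_)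
open import Function.Construct.Symmetry using (↔-sym)
open import Relation.Binary.Definitions using (DecidableEquality)
open import Relation.Binary.PropositionalEquality
open import Relation.Nullary using (yes; no)

open import Defs

open Inverse using (to; from)

infixl 5 _!?_

_!?_ : {X : Set} → List X → ℕ → Maybe X
[]       !? _     = nothing
(x ∷ xs) !? zero  = just x
(x ∷ xs) !? suc i = xs !? i

module _ {X : Set} where

  map-!? : {Y : Set} (g : X → Y) (xs : List X) (i : ℕ) → map g xs !? i ≡ Maybe.map g (xs !? i)
  map-!? g []       i       = refl
  map-!? g (x ∷ xs) zero    = refl
  map-!? g (x ∷ xs) (suc i) = map-!? g xs i

  take-!?-< : ∀ m i (xs : List X) → i < m → take m xs !? i ≡ xs !? i
  take-!?-< (suc m) i       []       _         = refl
  take-!?-< (suc m) zero    (x ∷ xs) _         = refl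
  take-!?-< (suc m) (suc i) (x ∷ xs) (s≤s i<m) = take-!?-< m i xs i<m

  take-!?-≥ : ∀ m i (xs : List X) → m ≤ i → take m xs !? i ≡ nothing
  take-!?-≥ zero    i       xs       _         = refl
  take-!?-≥ (suc m) i       []       _         = refl
  take-!?-≥ (suc m) (suc i) (x ∷ xs) (s≤s m≤i) = take-!?-≥ m i xs m≤i

  drop-!? : ∀ m i (xs : List X) → drop m xs !? i ≡ xs !? (m + i)
  drop-!? zero    i xs       = refl
  drop-!? (suc m) i []       = refl
  drop-!? (suc m) i (x ∷ xs) = drop-!? m i xs

  !?-≥ : (xs : List X) (i : ℕ) → length xs ≤ i → xs !? i ≡ nothing
  !?-≥ []       i       _         = refl
  !?-≥ (x ∷ xs) (suc i) (s≤s |xs|≤i) = !?-≥ xs i |xs|≤i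

  !?-ext : (xs ys : List X) → (∀ i → xs !? i ≡ ys !? i) → xs ≡ ys
  !?-ext []       []       _    = refl
  !?-ext []       (y ∷ ys) same with same zero
  ... | ()
  !?-ext (x ∷ xs) []       same with same zero
  ... | ()
  !?-ext (x ∷ xs) (y ∷ ys) same with same zero
  ... | refl = cong (x ∷_) (!?-ext xs ys (same ∘ suc))

module _ {S P : Set} where

  act? : (P → P) → Maybe (S ⊎ P) → Maybe (S ⊎ P)
  act? h = Maybe.map (actLetter h)

  act?-∘ : (h₁ h₂ : P → P) (m : Maybe (S ⊎ P)) → act? (h₁ ∘ h₂) m ≡ act? h₁ (act? h₂ m)
  act?-∘ h₁ h₂ nothing         = refl
  act?-∘ h₁ h₂ (just (inj₁ s)) = refl
  act?-∘ h₁ h₂ (just (inj₂ a)) = refl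

  act?-from-to : (f : P ↔ P) (m : Maybe (S ⊎ P)) → act? (from f) (act? (to f) m) ≡ m
  act?-from-to f nothing         = refl
  act?-from-to f (just (inj₁ s)) = refl
  act?-from-to f (just (inj₂ a)) = cong (just ∘ inj₂) (Inverse.strictlyInverseʳ f a)

  IsParam : Maybe (S ⊎ P) → Set
  IsParam m = ∃ λ a → m ≡ just (inj₂ a)

  act?-param⁺ : (h : P → P) (m : Maybe (S ⊎ P)) → IsParam m → IsParam (act? h m)
  act?-param⁺ h _ (a , refl) = h a , refl

  act?-param⁻ : (h : P → P) (m : Maybe (S ⊎ P)) → IsParam (act? h m) → IsParam m
  act?-param⁻ h (just (inj₂ a)) _       = a , refl
  act?-param⁻ h (just (inj₁ s)) (_ , ())
  act?-param⁻ h nothing         (_ , ())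

  IsParamAt : PString S P → ℕ → Set
  IsParamAt w i = IsParam (w !? i)

  Covers : PString S P → List P → Set
  Covers w A = ∀ {i a} → w !? i ≡ just (inj₂ a) → a ∈ A

  paramChars-covers : (_≟_ : DecidableEquality P) (w : PString S P) → Covers w (paramChars _≟_ w)
  paramChars-covers _≟_ w eq = ∈-deduplicate⁺ _≟_ (∈-params w eq)
    where
    ∈-params : ∀ (v : PString S P) {i a} → v !? i ≡ just (inj₂ a) → a ∈ mapMaybe paramOf v
    ∈-params (inj₂ b ∷ v) {zero}  refl = here refl
    ∈-params (inj₁ s ∷ v) {suc i} eq   = ∈-params v eq
    ∈-params (inj₂ b ∷ v) {suc i} eq   = there (∈-params v eq)
    ∈-params (inj₁ s ∷ v) {zero}  ()
    ∈-params []           {_}     ()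

  Periodic : PString S P → ℕ → (P → P) → Set
  Periodic w p h = ∀ i → i + p < length w → act? h (w !? i) ≡ w !? (i + p)

  isPeriod⇒periodic : (w : PString S P) (p : ℕ) → IsPeriod w p → ∃ λ (f : P ↔ P) → Periodic w p (to f)
  isPeriod⇒periodic w p (_ , _ , f , act-prefix≡suffix) = f , λ i i+p<n → begin
    act? (to f) (w !? i)                     ≡⟨ cong (act? (to f)) (take-!?-< (n ∸ p) i w (m+n≤o⇒m≤o∸n (suc i) i+p<n)) ⟨
    act? (to f) (take (n ∸ p) w !? i)        ≡⟨ map-!? (actLetter (to f)) (take (n ∸ p) w) i ⟨
    act (to f) (take (n ∸ p) w) !? i         ≡⟨ cong (_!? i) act-prefix≡suffix ⟩
    drop p w !? i                            ≡⟨ drop-!? p i w ⟩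
    w !? (p + i)                             ≡⟨ cong (w !?_) (+-comm p i) ⟩
    w !? (i + p)                             ∎
    where
    open ≡-Reasoning
    n = length w

  periodic⇒isPeriod : (w : PString S P) (p : ℕ) → 1 ≤ p → p ≤ length w →
                      (f : P ↔ P) → Periodic w p (to f) → IsPeriod w p
  periodic⇒isPeriod w p 1≤p p≤n f periodic = 1≤p , p≤n , f , !?-ext _ _ agree
    where
    open ≡-Reasoning
    n = length w
    agree : ∀ i → act (to f) (take (n ∸ p) w) !? i ≡ drop p w !? i
    agree i with i <? n ∸ p
    ... | yes i<n∸p = begin
      act (to f) (take (n ∸ p) w) !? i   ≡⟨ map-!? (actLetter (to f)) (take (n ∸ p) w) i ⟩
      act? (to f) (take (n ∸ p) w !? i)  ≡⟨ cong (act? (to f)) (take-!?-< (n ∸ p) i w i<n∸p) ⟩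
      act? (to f) (w !? i)               ≡⟨ periodic i (subst (i + p <_) (m∸n+n≡m p≤n) (+-monoˡ-< p i<n∸p)) ⟩
      w !? (i + p)                       ≡⟨ cong (w !?_) (+-comm i p) ⟩
      w !? (p + i)                       ≡⟨ drop-!? p i w ⟨
      drop p w !? i                      ∎
    ... | no i≮n∸p = begin
      act (to f) (take (n ∸ p) w) !? i   ≡⟨ map-!? (actLetter (to f)) (take (n ∸ p) w) i ⟩
      act? (to f) (take (n ∸ p) w !? i)  ≡⟨ cong (act? (to f)) (take-!?-≥ (n ∸ p) i w (≮⇒≥ i≮n∸p)) ⟩
      nothing                            ≡⟨ !?-≥ w (p + i) (subst (_≤ p + i) (m+[n∸m]≡n p≤n) (+-monoʳ-≤ p (≮⇒≥ i≮n∸p))) ⟨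
      w !? (p + i)                       ≡⟨ drop-!? p i w ⟨
      drop p w !? i                      ∎

module OnePeriod {S P : Set} {w : PString S P} {q : ℕ} {h : P → P} (periodic : Periodic w q h) where

  param-back : ∀ i → i + q < length w → IsParamAt w (i + q) → IsParamAt w i
  param-back i i+q<n ip = act?-param⁻ h (w !? i) (subst IsParam (sym (periodic i i+q<n)) ip)

  param-forth : ∀ i → i + q < length w → IsParamAt w i → IsParamAt w (i + q)
  param-forth i i+q<n ip = subst IsParam (periodic i i+q<n) (act?-param⁺ h (w !? i) ip)

  params-back : ∀ m i → i + m * q < length w → IsParamAt w (i + m * q) → IsParamAt w i
  params-back zero    i _  ip rewrite +-identityʳ i = ip
  params-back (suc m) i lt ip rewrite sym (+-assoc i q (m * q)) =
    param-back i (≤-<-trans (m≤m+n (i + q) (m * q)) lt) (params-back m (i + q) lt ip)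

  same-letters-shift : ∀ m {a b} → w !? a ≡ w !? b → a + m * q < length w → b + m * q < length w →
                       w !? (a + m * q) ≡ w !? (b + m * q)
  same-letters-shift zero {a} {b} same _ _ rewrite +-identityʳ a | +-identityʳ b = same
  same-letters-shift (suc m) {a} {b} same a+mq<n b+mq<n
    rewrite sym (+-assoc a q (m * q)) | sym (+-assoc b q (m * q)) =
    same-letters-shift m (begin
      w !? (a + q)        ≡⟨ periodic a (≤-<-trans (m≤m+n (a + q) (m * q)) a+mq<n) ⟨
      act? h (w !? a)     ≡⟨ cong (act? h) same ⟩
      act? h (w !? b)     ≡⟨ periodic b (≤-<-trans (m≤m+n (b + q) (m * q)) b+mq<n) ⟩
      w !? (b + q)        ∎) a+mq<n b+mq<n
    where open ≡-Reasoning

letters-collide : {S P : Set} {w : PString S P} {A : List P} {m : ℕ} → Covers w A → length A < m →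
                  (pos : Fin m → ℕ) → (∀ t → IsParamAt w (pos t)) →
                  ∃₂ λ i j → i Fin.< j × w !? pos i ≡ w !? pos j
letters-collide {P = P} {w = w} {A} {m} covers |A|<m pos params = collide (pigeonhole |A|<m (index ∘ located))
  where
  open ≡-Reasoning
  letter : Fin m → P
  letter t = proj₁ (params t)
  located : ∀ t → letter t ∈ A
  located t = covers (proj₂ (params t))
  collide : (∃₂ λ i j → i Fin.< j × index (located i) ≡ index (located j)) →
            ∃₂ λ i j → i Fin.< j × w !? pos i ≡ w !? pos j
  collide (i , j , i<j , same-index) = i , j , i<j , (begin
    w !? pos i                                  ≡⟨ proj₂ (params i) ⟩
    just (inj₂ (letter i))                      ≡⟨ cong (just ∘ inj₂) (lookup-index (located i)) ⟩
    just (inj₂ (lookup A (index (located i))))  ≡⟨ cong (just ∘ inj₂ ∘ lookup A) same-index ⟩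
    just (inj₂ (lookup A (index (located j))))  ≡⟨ cong (just ∘ inj₂) (lookup-index (located j)) ⟨
    just (inj₂ (letter j))                      ≡⟨ proj₂ (params j) ⟨
    w !? pos j                                  ∎)

module TwoPeriods {S P : Set} {w : PString S P} {p r : ℕ} (f g : P ↔ P)
  (p-periodic : Periodic w p (to f)) (q-periodic : Periodic w (p + r) (to g))
  (p+q≤n : p + (p + r) ≤ length w) where

  private
    n = length w
    q = p + r
    F G : Maybe (S ⊎ P) → Maybe (S ⊎ P)
    F = act? (to f)
    G = act? (to g)
    module ByP = OnePeriod {w = w} p-periodic
    module ByQ = OnePeriod {w = w} q-periodic

  -- Either r + o + p = o + q lies inside w, or o = o′ + p with o′ + q = r + o.
  param-step-down : ∀ o → r + o < n → IsParamAt w (r + o) → IsParamAt w o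
  param-step-down o r+o<n ip with o + q <? n
  ... | yes o+q<n = ByQ.param-back o o+q<n
                      (subst (IsParamAt w) (r+o+p≡o+q r o p) (ByP.param-forth (r + o) r+o+p<n ip))
    where
    r+o+p≡o+q : ∀ r o p → r + o + p ≡ o + (p + r)
    r+o+p≡o+q = solve-∀
    r+o+p<n : r + o + p < n
    r+o+p<n = subst (_< n) (sym (r+o+p≡o+q r o p)) o+q<n
  ... | no o+q≮n with m≤n⇒∃[o]m+o≡n (+-cancelʳ-≤ q p o (≤-trans p+q≤n (≮⇒≥ o+q≮n)))
  ... | o′ , refl = subst (IsParamAt w) (+-comm o′ p)
    (ByP.param-forth o′ o′+p<n (ByQ.param-back o′ o′+q<n (subst (IsParamAt w) r+o≡o′+q ip)))
    where
    r+o≡o′+q : r + (p + o′) ≡ o′ + q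
    r+o≡o′+q = rearrange r p o′
      where
      rearrange : ∀ r p o′ → r + (p + o′) ≡ o′ + (p + r)
      rearrange = solve-∀
    o′+q<n : o′ + q < n
    o′+q<n = subst (_< n) r+o≡o′+q r+o<n
    o′+p<n : o′ + p < n
    o′+p<n = ≤-<-trans (+-monoʳ-≤ o′ (m≤m+n p r)) o′+q<n

  param-below : 1 ≤ r → ∀ x → x < n → IsParamAt w x → ∃ λ z → z < r × IsParamAt w z
  param-below 1≤r = <-rec _ descend
    where
    descend : ∀ x → (∀ {y} → y < x → y < n → IsParamAt w y → ∃ λ z → z < r × IsParamAt w z) →
              x < n → IsParamAt w x → ∃ λ z → z < r × IsParamAt w z
    descend x below x<n ip with x <? r
    ... | yes x<r = x , x<r , ip
    ... | no x≮r with m≤n⇒∃[o]m+o≡n (≮⇒≥ x≮r)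
    ... | o , refl = below (m<n+m o 1≤r) (≤-<-trans (m≤n+m o r) x<n) (param-step-down o x<n ip)

  commute-at : ∀ z → z + q + p < n → F (G (w !? z)) ≡ G (F (w !? z))
  commute-at z z+q+p<n = begin
    F (G (w !? z))    ≡⟨ cong F (q-periodic z z+q<n) ⟩
    F (w !? (z + q))  ≡⟨ p-periodic (z + q) z+q+p<n ⟩
    w !? (z + q + p)  ≡⟨ cong (w !?_) z+q+p≡z+p+q ⟩
    w !? (z + p + q)  ≡⟨ q-periodic (z + p) z+p+q<n ⟨
    G (w !? (z + p))  ≡⟨ cong G (p-periodic z z+p<n) ⟨
    G (F (w !? z))    ∎
    where
    open ≡-Reasoning
    z+q+p≡z+p+q : z + q + p ≡ z + p + q
    z+q+p≡z+p+q = xy∙z≈xz∙y z q p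
    z+q<n : z + q < n
    z+q<n = ≤-<-trans (m≤m+n (z + q) p) z+q+p<n
    z+p+q<n : z + p + q < n
    z+p+q<n = subst (_< n) z+q+p≡z+p+q z+q+p<n
    z+p<n : z + p < n
    z+p<n = ≤-<-trans (m≤m+n (z + p) q) z+p+q<n

  module EarlyOccurrence {A : List P} {k : ℕ} (covers : Covers w A) (|A|≤1+k : length A ≤ suc k)
                    (bound : q * (2 + k) ≤ n) (1≤r : 1 ≤ r) where

    late⇒k*q≤ : ∀ y → n ≤ y + q + p → k * q ≤ y
    late⇒k*q≤ y n≤y+q+p = +-cancelʳ-≤ (q + q) (k * q) y (begin
      k * q + (q + q)  ≡⟨ kq+2q≡q[2+k] k q ⟩
      q * (2 + k)      ≤⟨ bound ⟩
      n                ≤⟨ n≤y+q+p ⟩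
      y + q + p        ≤⟨ +-monoʳ-≤ (y + q) (m≤m+n p r) ⟩
      y + q + q        ≡⟨ +-assoc y q q ⟩
      y + (q + q)      ∎)
      where
      open ≤-Reasoning
      kq+2q≡q[2+k] : ∀ k q → k * q + (q + q) ≡ q * (2 + k)
      kq+2q≡q[2+k] = solve-∀

    module Spaced {y : ℕ} (k*q≤y : k * q ≤ y) (z₀ : ℕ) where

      -- spaced (fsuc u) = y − u·q
      spaced : Fin (2 + k) → ℕ
      spaced fzero    = z₀
      spaced (fsuc u) = y ∸ k * q + (k ∸ toℕ u) * q

      spaced-reaches : ∀ u → spaced (fsuc u) + toℕ u * q ≡ y
      spaced-reaches u = begin
        y ∸ k * q + (k ∸ toℕ u) * q + toℕ u * q    ≡⟨ +-assoc (y ∸ k * q) _ _ ⟩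
        y ∸ k * q + ((k ∸ toℕ u) * q + toℕ u * q)  ≡⟨ cong (y ∸ k * q +_) (*-distribʳ-+ q (k ∸ toℕ u) (toℕ u)) ⟨
        y ∸ k * q + (k ∸ toℕ u + toℕ u) * q        ≡⟨ cong (λ m → y ∸ k * q + m * q) (m∸n+n≡m (≤-pred (toℕ<n u))) ⟩
        y ∸ k * q + k * q                          ≡⟨ m∸n+n≡m k*q≤y ⟩
        y                                          ∎
        where open ≡-Reasoning

      spaced-params : IsParamAt w y → y < n → IsParamAt w z₀ → ∀ t → IsParamAt w (spaced t)
      spaced-params _  _   z₀-param fzero    = z₀-param
      spaced-params ip y<n _        (fsuc u) = ByQ.params-back (toℕ u) (spaced (fsuc u))
        (subst (_< n) (sym (spaced-reaches u)) y<n) (subst (IsParamAt w) (sym (spaced-reaches u)) ip)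

      collision⇒early-occurrence : y + q < n → z₀ < r →
        (∃₂ λ i j → i Fin.< j × w !? spaced i ≡ w !? spaced j) → ∃ λ z → z + q + p < n × w !? z ≡ w !? y
      collision⇒early-occurrence y+q<n z₀<r (fzero , fsuc u , _ , same) =
        z , z+q+p<n , trans (ByQ.same-letters-shift (toℕ u) same z<n spaced+uq<n) (cong (w !?_) (spaced-reaches u))
        where
        z = z₀ + toℕ u * q
        z+q+p<n : z + q + p < n
        z+q+p<n = begin-strict
          z₀ + toℕ u * q + q + p  <⟨ +-monoˡ-< p (+-monoˡ-< q (+-mono-<-≤ z₀<r (*-monoˡ-≤ q (≤-pred (toℕ<n u))))) ⟩
          r + k * q + q + p       ≡⟨ r+kq+q+p≡q[2+k] r k p ⟩
          q * (2 + k)             ≤⟨ bound ⟩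
          n                       ∎
          where
          open ≤-Reasoning
          r+kq+q+p≡q[2+k] : ∀ r k p → r + k * (p + r) + (p + r) + p ≡ (p + r) * (2 + k)
          r+kq+q+p≡q[2+k] = solve-∀
        z<n : z < n
        z<n = ≤-<-trans (m≤m+n z (q + p)) (subst (_< n) (+-assoc z q p) z+q+p<n)
        spaced+uq<n : spaced (fsuc u) + toℕ u * q < n
        spaced+uq<n = subst (_< n) (sym (spaced-reaches u)) (≤-<-trans (m≤m+n y q) y+q<n)
      collision⇒early-occurrence y+q<n _ (fsuc u₁ , fsuc u₂ , s≤s u₁<u₂ , same) =
        z , z+q+p<n , trans (ByQ.same-letters-shift (toℕ u₁) (sym same) z<n spaced+uq<n) (cong (w !?_) (spaced-reaches u₁))
        where
        z = spaced (fsuc u₂) + toℕ u₁ * q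
        z+q≤y : z + q ≤ y
        z+q≤y = begin
          spaced (fsuc u₂) + toℕ u₁ * q + q    ≡⟨ xy∙z≈xz∙y (spaced (fsuc u₂)) (toℕ u₁ * q) q ⟩
          spaced (fsuc u₂) + q + toℕ u₁ * q    ≡⟨ +-assoc (spaced (fsuc u₂)) q (toℕ u₁ * q) ⟩
          spaced (fsuc u₂) + suc (toℕ u₁) * q  ≤⟨ +-monoʳ-≤ (spaced (fsuc u₂)) (*-monoˡ-≤ q u₁<u₂) ⟩
          spaced (fsuc u₂) + toℕ u₂ * q        ≡⟨ spaced-reaches u₂ ⟩
          y                                    ∎
          where open ≤-Reasoning
        z+q+p<n : z + q + p < n
        z+q+p<n = ≤-<-trans (+-mono-≤ z+q≤y (m≤m+n p r)) y+q<n
        z<n : z < n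
        z<n = ≤-<-trans (m≤m+n z q) (≤-<-trans z+q≤y (≤-<-trans (m≤m+n y q) y+q<n))
        spaced+uq<n : spaced (fsuc u₁) + toℕ u₁ * q < n
        spaced+uq<n = subst (_< n) (sym (spaced-reaches u₁)) (≤-<-trans (m≤m+n y q) y+q<n)

    late-param-recurs-early : ∀ y → y + q < n → n ≤ y + q + p → IsParamAt w y →
                              ∃ λ z → z + q + p < n × w !? z ≡ w !? y
    late-param-recurs-early y y+q<n n≤y+q+p ip = from-below (param-below 1≤r y y<n ip)
      where
      y<n : y < n
      y<n = ≤-<-trans (m≤m+n y q) y+q<n
      from-below : (∃ λ z₀ → z₀ < r × IsParamAt w z₀) → ∃ λ z → z + q + p < n × w !? z ≡ w !? y
      from-below (z₀ , z₀<r , z₀-param) = collision⇒early-occurrence y+q<n z₀<r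
        (letters-collide {w = w} covers (s≤s |A|≤1+k) spaced (spaced-params ip y<n z₀-param))
        where open Spaced (late⇒k*q≤ y n≤y+q+p) z₀

    param-recurs-early : ∀ y → y + q < n → IsParamAt w y → ∃ λ z → z + q + p < n × w !? z ≡ w !? y
    param-recurs-early y y+q<n ip with y + q + p <? n
    ... | yes y+q+p<n = y , y+q+p<n , refl
    ... | no  y+q+p≮n = late-param-recurs-early y y+q<n (≮⇒≥ y+q+p≮n) ip

    commute : ∀ y → y + q < n → F (G (w !? y)) ≡ G (F (w !? y))
    commute y y+q<n with w !? y in letter
    ... | nothing       = refl
    ... | just (inj₁ s) = refl
    ... | just (inj₂ a) with param-recurs-early y y+q<n (a , letter)
    ... | z , z+q+p<n , same = subst (λ m → F (G m) ≡ G (F m)) (trans same letter) (commute-at z z+q+p<n)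

    difference-periodic : Periodic w r (from f ∘ to g)
    difference-periodic x x+r<n with x + q <? n
    ... | yes x+q<n = begin
      act? (from f ∘ to g) (w !? x)     ≡⟨ act?-∘ (from f) (to g) (w !? x) ⟩
      act? (from f) (G (w !? x))        ≡⟨ cong (act? (from f)) (q-periodic x x+q<n) ⟩
      act? (from f) (w !? (x + q))      ≡⟨ cong (act? (from f) ∘ (w !?_)) x+q≡x+r+p ⟩
      act? (from f) (w !? (x + r + p))  ≡⟨ cong (act? (from f)) (p-periodic (x + r) (subst (_< n) x+q≡x+r+p x+q<n)) ⟨
      act? (from f) (F (w !? (x + r)))  ≡⟨ act?-from-to f (w !? (x + r)) ⟩
      w !? (x + r)                      ∎
      where
      open ≡-Reasoning
      x+q≡x+r+p : x + q ≡ x + r + p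
      x+q≡x+r+p = trans (cong (x +_) (+-comm p r)) (sym (+-assoc x r p))
    ... | no x+q≮n with m≤n⇒∃[o]m+o≡n (+-cancelʳ-≤ q p x (≤-trans p+q≤n (≮⇒≥ x+q≮n)))
    ... | y , refl = begin
      act? (from f ∘ to g) (w !? (p + y))   ≡⟨ cong (act? (from f ∘ to g) ∘ (w !?_)) (+-comm p y) ⟩
      act? (from f ∘ to g) (w !? (y + p))   ≡⟨ cong (act? (from f ∘ to g)) (p-periodic y y+p<n) ⟨
      act? (from f ∘ to g) (F (w !? y))     ≡⟨ act?-∘ (from f) (to g) (F (w !? y)) ⟩
      act? (from f) (G (F (w !? y)))        ≡⟨ cong (act? (from f)) (commute y y+q<n) ⟨
      act? (from f) (F (G (w !? y)))        ≡⟨ act?-from-to f (G (w !? y)) ⟩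
      G (w !? y)                            ≡⟨ q-periodic y y+q<n ⟩
      w !? (y + q)                          ≡⟨ cong (w !?_) y+q≡p+y+r ⟩
      w !? (p + y + r)                      ∎
      where
      open ≡-Reasoning
      y+q≡p+y+r : y + q ≡ p + y + r
      y+q≡p+y+r = trans (sym (+-assoc y p r)) (cong (_+ r) (+-comm y p))
      y+q<n : y + q < n
      y+q<n = subst (_< n) (sym y+q≡p+y+r) x+r<n
      y+p<n : y + p < n
      y+p<n = ≤-<-trans (+-monoʳ-≤ y (m≤m+n p r)) y+q<n

module _ {S P : Set} {w : PString S P} {A : List P} {k : ℕ}
         (covers : Covers w A) (|A|≤1+k : length A ≤ suc k) where

  difference-isPeriod : ∀ {p r} → IsPeriod w p → IsPeriod w (p + r) → 1 ≤ r →
                        (p + r) * (2 + k) ≤ length w → IsPeriod w r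
  difference-isPeriod {p} {r} p-period q-period 1≤r bound
    with isPeriod⇒periodic w p p-period | isPeriod⇒periodic w (p + r) q-period
  ... | f , p-periodic | g , q-periodic =
    periodic⇒isPeriod w r 1≤r r≤n (↔-sym f ↔-∘ g) difference-periodic
    where
    n = length w
    r≤n : r ≤ n
    r≤n = ≤-trans (m≤n+m r p) (proj₁ (proj₂ q-period))
    p+q≤n : p + (p + r) ≤ n
    p+q≤n = begin
      p + (p + r)        ≤⟨ +-monoˡ-≤ (p + r) (m≤m+n p r) ⟩
      p + r + (p + r)    ≤⟨ +-monoʳ-≤ (p + r) (m≤m+n (p + r) (k * (p + r))) ⟩
      (2 + k) * (p + r)  ≡⟨ *-comm (2 + k) (p + r) ⟩
      (p + r) * (2 + k)  ≤⟨ bound ⟩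
      n                  ∎
      where open ≤-Reasoning
    open TwoPeriods {w = w} f g p-periodic q-periodic p+q≤n
    open EarlyOccurrence covers |A|≤1+k bound 1≤r

  smallest-period-∣ : ∀ {p} → IsSmallestPeriod w p → ∀ q → IsPeriod w q → q * (2 + k) ≤ length w → p ∣ q
  smallest-period-∣ {p} (p-period , p-minimal) = <-rec _ euclid-step
    where
    euclid-step : ∀ q → (∀ {q′} → q′ < q → IsPeriod w q′ → q′ * (2 + k) ≤ length w → p ∣ q′) →
                  IsPeriod w q → q * (2 + k) ≤ length w → p ∣ q
    euclid-step q divides-smaller q-period bound with m≤n⇒∃[o]m+o≡n (p-minimal q q-period)
    ... | zero   , refl = ∣m∣n⇒∣m+n ∣-refl (p ∣0)
    ... | suc r′ , refl = ∣m∣n⇒∣m+n ∣-refl (divides-smaller r<q r-period r-bound)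
      where
      r<q : suc r′ < p + suc r′
      r<q = m<n+m (suc r′) (proj₁ p-period)
      r-period : IsPeriod w (suc r′)
      r-period = difference-isPeriod p-period q-period (s≤s z≤n) bound
      r-bound : suc r′ * (2 + k) ≤ length w
      r-bound = ≤-trans (*-monoˡ-≤ (2 + k) (<⇒≤ r<q)) bound

length-≢[] : {X : Set} {xs : List X} → xs ≢ [] → ∃ λ k → length xs ≡ suc k
length-≢[] {xs = []}     xs≢[] = ⊥-elim (xs≢[] refl)
length-≢[] {xs = x ∷ xs} _     = length xs , refl

corollary1 : {S P : Set} (_≟_ : DecidableEquality P) (w : PString S P) (q : ℕ) →
    paramChars _≟_ w ≢ [] →
    IsPeriod w q →
    q * suc (length (paramChars _≟_ w)) ≤ length w →
    ∀ p → IsSmallestPeriod w p → p ∣ q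
corollary1 _≟_ w q Π≢[] q-period bound p smallest with length-≢[] Π≢[]
... | k , |Π|≡1+k =
  smallest-period-∣ (paramChars-covers _≟_ w) (≤-reflexive |Π|≡1+k) smallest q q-period
    (subst (λ m → q * suc m ≤ length w) |Π|≡1+k bound)
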